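{- Let $X = 2^\omega \oplus 1$ be the topological space obtained from the Cantor space $2^\omega$ by adjoining one isolated point (i.e. the topological sum of $2^\omega$ and a one-point space). Then $X\times 2^\omega$ has the UU property.
   Context: For topological spaces $X$ (the parameter space) and $Y$ (the base space), $X\times Y$ is said to have the UU (uniquely universal) property if there exists an open set $U\subseteq X\times Y$ such that for every open set $W\subseteq Y$ there is a unique $x\in X$ with $U_x=W$, where $U_x=\{y\in Y: (x,y)\in U\}$. Here $2^\omega$ carries the product topology. -}

module Defs where

open import Data.Nat using (ℕ; _<_)
open import Data.Bool using (Bool)
open import Data.Unit using (⊤; tt)
open import Data.Sum using (_⊎_; inj₁; inj₂)
open import Data.Product using (Σ; ∃; ∃-syntax; _×_; _,_)
open import Relation.Binary.PropositionalEquality using (_≡_)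
open import Function.Bundles using (_⇔_)

Cantor : Set
Cantor = ℕ → Bool

Subset : Set → Set₁
Subset A = A → Set

Cyl : Cantor → ℕ → Subset Cantor
Cyl α n β = ∀ i → i < n → β i ≡ α i

IsOpenC : Subset Cantor → Set
IsOpenC W = ∀ α → W α → ∃[ n ] (∀ β → Cyl α n β → W β)

X : Set
X = Cantor ⊎ ⊤

NbhdX : X → ℕ → Subset X
NbhdX (inj₁ α) n (inj₁ β) = Cyl α n β
NbhdX (inj₁ α) n (inj₂ _) = Data.Empty.⊥
  where import Data.Empty
NbhdX (inj₂ _) n (inj₁ β) = Data.Empty.⊥
  where import Data.Empty
NbhdX (inj₂ _) n (inj₂ _) = ⊤

IsOpenXC : Subset (X × Cantor) → Set
IsOpenXC U = ∀ x α → U (x , α) →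
  ∃[ m ] ∃[ n ] (∀ x' β → NbhdX x m x' → Cyl α n β → U (x' , β))

section : Subset (X × Cantor) → X → Subset Cantor
section U x y = U (x , y)

_≐_ : {A : Set} → Subset A → Subset A → Set
P ≐ Q = ∀ a → (P a ⇔ Q a)

-- Equality of points of X (pointwise on the Cantor summand; no funext in Agda).
_≈X_ : X → X → Set
inj₁ α ≈X inj₁ β = ∀ i → α i ≡ β i
inj₁ _ ≈X inj₂ _ = Data.Empty.⊥
  where import Data.Empty
inj₂ _ ≈X inj₁ _ = Data.Empty.⊥
  where import Data.Empty
inj₂ _ ≈X inj₂ _ = ⊤

UU-X×Cantor : Set₁
UU-X×Cantor =
  Σ (Subset (X × Cantor)) λ U →
    IsOpenXC U ×
    ((W : Subset Cantor) → IsOpenC W →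
       Σ X λ x → (section U x ≐ W) ×
         (∀ x' → section U x' ≐ W → x' ≈X x))

module Submission where

-- Points of the Cantor summand of X = 2^ω ⊕ 1 are read as *codes* of
-- open sets of 2^ω.  The first bits of a code a fix its shape:
--   1 ⟨l,r interleaved⟩   both halves of the coded set are proper, namely 0·⟦l⟧ ∪ 1·⟦r⟧;
--   0 1 r                 the left half is full: the set is 0·2^ω ∪ 1·⟦r⟧;
--   0 0 l                 the right half is full: the set is 0·⟦l⟧ ∪ 1·2^ω.
-- The decoded set ⟦a⟧ is defined inductively; it is open jointly in the code and
-- the point, and never full (one can always descend into a proper half).  The
-- isolated point of X stands for the full set.  Conversely, using excluded middle
-- to decide which halves of a proper open V are full, a code of V is obtained as
-- the diagonal limit of finite approximations; proper halves are coded recursively.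
-- Finally ⟦a⟧ determines a: the shape is read off from which halves are full,
-- and the children by induction on the number of bits compared.

open import Defs
open import Level using (0ℓ)
open import Axiom.ExcludedMiddle using (ExcludedMiddle)
open import Data.Nat using (ℕ; zero; suc; _+_; _≤_; _<_; z≤n; s≤s)
open import Data.Nat.Properties
  using (+-suc; +-comm; +-mono-<; m≤m+n; m≤n+m; m≤n⇒m≤1+n; n≤1+n; n<1+n; <⇒≤; <-≤-trans; ≤-<-trans)
open import Data.Bool using (Bool; true; false)
open import Data.Unit using (⊤; tt)
open import Data.Empty using (⊥; ⊥-elim)
open import Data.Sum using (inj₁; inj₂)
open import Data.Product using (Σ; ∃-syntax; _×_; _,_)
open import Relation.Binary.PropositionalEquality
open import Relation.Nullary using (¬_; Dec; yes; no)
open import Function.Bundles using (_⇔_; mk⇔; Equivalence)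
import Function.Properties.Equivalence as ⇔

open Equivalence using (to; from)

tl : Cantor → Cantor
tl y i = y (suc i)

cons : Bool → Cantor → Cantor
cons b β zero = b
cons b β (suc i) = β i

cons-head-tl : ∀ y → y ≗ cons (y 0) (tl y)
cons-head-tl y zero = refl
cons-head-tl y (suc i) = refl

cyl-mono : ∀ {α β m n} → m ≤ n → Cyl α n β → Cyl α m β
cyl-mono m≤n c i i<m = c i (<-≤-trans i<m m≤n)

tl-cyl : ∀ {α β n} → Cyl α (suc n) β → Cyl (tl α) n (tl β)
tl-cyl c i i<n = c (suc i) (s≤s i<n)

cons-cyl : ∀ {y β k} → Cyl (tl y) k β → Cyl y (suc k) (cons (y 0) β)
cons-cyl c zero _ = refl
cons-cyl c (suc i) (s≤s i<k) = c i i<k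

interleave : Cantor → Cantor → Cantor
interleave l r zero = l 0
interleave l r (suc i) = interleave r (tl l) i

evens : Cantor → Cantor
evens t zero = t 0
evens t (suc j) = evens (tl (tl t)) j

evens-at : ∀ t j → evens t j ≡ t (j + j)
evens-at t zero = refl
evens-at t (suc j) = trans (evens-at (tl (tl t)) j) (cong (λ n → t (suc n)) (sym (+-suc j j)))

evens-interleave : ∀ l r → evens (interleave l r) ≗ l
evens-interleave l r zero = refl
evens-interleave l r (suc j) = evens-interleave (tl l) (tl r) j

unzip : ∀ t → t ≗ interleave (evens t) (evens (tl t))
unzip t zero = refl
unzip t (suc i) = unzip (tl t) i

evens-cyl : ∀ {t t' m} → Cyl t (m + m) t' → Cyl (evens t) m (evens t')
evens-cyl {t} {t'} c j j<m =
  trans (evens-at t' j) (trans (c (j + j) (+-mono-< j<m j<m)) (sym (evens-at t j)))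

interleave-causal : ∀ i {l r l' r'} →
  (∀ j → j ≤ i → l' j ≡ l j) → (∀ j → j ≤ i → r' j ≡ r j) →
  interleave l' r' i ≡ interleave l r i
interleave-causal zero el er = el 0 z≤n
interleave-causal (suc i) el er =
  interleave-causal i (λ j j≤i → er j (m≤n⇒m≤1+n j≤i)) (λ j j≤i → el (suc j) (s≤s j≤i))

Full : Subset Cantor → Set
Full V = ∀ β → V β

Half : Bool → Subset Cantor → Subset Cantor
Half c V β = V (cons c β)

open-resp : ∀ {V α β} → IsOpenC V → V α → (∀ i → β i ≡ α i) → V β
open-resp {α = α} {β} oV v p = let (n , nb) = oV α v in nb β (λ i _ → p i)

from-half : ∀ {V y} → IsOpenC V → Half (y 0) V (tl y) → V y
from-half {y = y} oV h = open-resp oV h (cons-head-tl y)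

Half-open : ∀ {V} c → IsOpenC V → IsOpenC (Half c V)
Half-open c oV α v =
  let (n , nb) = oV (cons c α) v
  in n , λ β cy → nb (cons c β) (cyl-mono (n≤1+n n) (cons-cyl cy))

full-from-halves : ∀ {V} → IsOpenC V → (∀ c → Full (Half c V)) → Full V
full-from-halves oV h y = from-half oV (h (y 0) (tl y))

data Shape : Set where
  bothPartial leftFull rightFull : Shape

-- HalfFull s c: in a code of shape s, the c-half of the coded set is full.
HalfFull : Shape → Bool → Set
HalfFull bothPartial c = ⊥
HalfFull leftFull false = ⊤
HalfFull leftFull true = ⊥
HalfFull rightFull false = ⊥
HalfFull rightFull true = ⊤

halfFull? : ∀ s c → Dec (HalfFull s c)
halfFull? bothPartial c = no λ ()
halfFull? leftFull false = yes tt
halfFull? leftFull true = no λ ()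
halfFull? rightFull false = no λ ()
halfFull? rightFull true = yes tt

profile-injective : ∀ s t →
  (∀ c → HalfFull s c → HalfFull t c) → (∀ c → HalfFull t c → HalfFull s c) → s ≡ t
profile-injective bothPartial bothPartial _ _ = refl
profile-injective bothPartial leftFull _ g = ⊥-elim (g false tt)
profile-injective bothPartial rightFull _ g = ⊥-elim (g true tt)
profile-injective leftFull bothPartial f _ = ⊥-elim (f false tt)
profile-injective leftFull leftFull _ _ = refl
profile-injective leftFull rightFull f _ = ⊥-elim (f false tt)
profile-injective rightFull bothPartial f _ = ⊥-elim (f true tt)
profile-injective rightFull leftFull f _ = ⊥-elim (f true tt)
profile-injective rightFull rightFull _ _ = refl

shapeFrom : Bool → Bool → Shape
shapeFrom true _ = bothPartial
shapeFrom false true = leftFull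
shapeFrom false false = rightFull

shapeOf : Cantor → Shape
shapeOf a = shapeFrom (a 0) (a 1)

shapeOf-local : ∀ {a a'} → Cyl a 2 a' → shapeOf a' ≡ shapeOf a
shapeOf-local c = cong₂ shapeFrom (c 0 (s≤s z≤n)) (c 1 (s≤s (s≤s z≤n)))

-- The code of the c-half of a code of shape s (meaningless for a full half).
child : Shape → Bool → Cantor → Cantor
child bothPartial false a = evens (tl a)
child bothPartial true a = evens (tl (tl a))
child leftFull _ a = tl (tl a)
child rightFull _ a = tl (tl a)

-- The code of shape s with children ch (only the children of proper halves are used).
build : Shape → (Bool → Cantor) → Cantor
build bothPartial ch = cons true (interleave (ch false) (ch true))
build leftFull ch = cons false (cons true (ch true))
build rightFull ch = cons false (cons false (ch false))

build-eta : ∀ a → a ≗ build (shapeFrom (a 0) (a 1)) (λ c → child (shapeFrom (a 0) (a 1)) c a)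
build-eta a i with a 0 in h0 | a 1 in h1
build-eta a zero | true | _ = h0
build-eta a (suc i) | true | _ = unzip (tl a) i
build-eta a zero | false | true = h0
build-eta a (suc zero) | false | true = h1
build-eta a (suc (suc i)) | false | true = refl
build-eta a zero | false | false = h0
build-eta a (suc zero) | false | false = h1
build-eta a (suc (suc i)) | false | false = refl

build-eta-at : ∀ {a s} → shapeOf a ≡ s → a ≗ build s (λ c → child s c a)
build-eta-at refl = build-eta _

shapeOf-build : ∀ s ch → shapeOf (build s ch) ≡ s
shapeOf-build bothPartial ch = refl
shapeOf-build leftFull ch = refl
shapeOf-build rightFull ch = refl

child-build : ∀ s ch c → ¬ HalfFull s c → child s c (build s ch) ≗ ch c
child-build bothPartial ch false _ = evens-interleave (ch false) (ch true)
child-build bothPartial ch true _ = evens-interleave (ch true) (tl (ch false))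
child-build leftFull ch false nf = ⊥-elim (nf tt)
child-build leftFull ch true _ = λ _ → refl
child-build rightFull ch false _ = λ _ → refl
child-build rightFull ch true nf = ⊥-elim (nf tt)

child-causal : ∀ s c {m a a'} → Cyl a (2 + (m + m)) a' → Cyl (child s c a) m (child s c a')
child-causal bothPartial false {m} cy = evens-cyl (cyl-mono (n≤1+n (m + m)) (tl-cyl cy))
child-causal bothPartial true cy = evens-cyl (tl-cyl (tl-cyl cy))
child-causal leftFull _ {m} cy = cyl-mono (m≤m+n m m) (tl-cyl (tl-cyl cy))
child-causal rightFull _ {m} cy = cyl-mono (m≤m+n m m) (tl-cyl (tl-cyl cy))

build-causal : ∀ s {k ch ch'} →
  (∀ c → ¬ HalfFull s c → Cyl (ch c) k (ch' c)) → Cyl (build s ch) (suc k) (build s ch')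
build-causal bothPartial h zero _ = refl
build-causal bothPartial h (suc i) (s≤s i<k) =
  interleave-causal i (λ j j≤i → h false (λ ()) j (≤-<-trans j≤i i<k))
                      (λ j j≤i → h true (λ ()) j (≤-<-trans j≤i i<k))
build-causal leftFull h zero _ = refl
build-causal leftFull h (suc zero) _ = refl
build-causal leftFull h (suc (suc i)) (s≤s i+1<k) = h true (λ ()) i (<⇒≤ i+1<k)
build-causal rightFull h zero _ = refl
build-causal rightFull h (suc zero) _ = refl
build-causal rightFull h (suc (suc i)) (s≤s i+1<k) = h false (λ ()) i (<⇒≤ i+1<k)

child-cong : ∀ s c {a a'} → a ≗ a' → child s c a ≗ child s c a'
child-cong s c p j = sym (child-causal s c {suc j} (λ i _ → sym (p i)) j (n<1+n j))

data _∈⟦_⟧ : Cantor → Cantor → Set where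
  in-full  : ∀ {y a} → HalfFull (shapeOf a) (y 0) → y ∈⟦ a ⟧
  in-child : ∀ {y a} → tl y ∈⟦ child (shapeOf a) (y 0) a ⟧ → y ∈⟦ a ⟧

⟦_⟧ : Cantor → Subset Cantor
⟦ a ⟧ y = y ∈⟦ a ⟧

∈-open : ∀ {y a} → y ∈⟦ a ⟧ →
  ∃[ m ] ∃[ n ] (∀ a' y' → Cyl a m a' → Cyl y n y' → y' ∈⟦ a' ⟧)
∈-open (in-full h) = 2 , 1 , λ a' y' ca cy →
  in-full (subst₂ HalfFull (sym (shapeOf-local ca)) (sym (cy 0 (s≤s z≤n))) h)
∈-open {y} {a} (in-child d) =
  let (m , n , nb) = ∈-open d
  in 2 + (m + m) , suc n , λ a' y' ca cy →
    in-child (subst₂ (λ s c → tl y' ∈⟦ child s c a' ⟧)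
                     (sym (shapeOf-local (cyl-mono (m≤m+n 2 (m + m)) ca)))
                     (sym (cy 0 (s≤s z≤n)))
                     (nb _ (tl y') (child-causal (shapeOf a) (y 0) ca) (tl-cyl cy)))

∈-resp : ∀ {y a a'} → a ≗ a' → y ∈⟦ a ⟧ → y ∈⟦ a' ⟧
∈-resp {y} {a' = a'} p d = let (m , n , nb) = ∈-open d in nb a' y (λ i _ → sym (p i)) (λ _ _ → refl)

module _ {a s ch} (a≗ : a ≗ build s ch) where

  shape-of-build : shapeOf a ≡ s
  shape-of-build = trans (shapeOf-local (λ i _ → a≗ i)) (shapeOf-build s ch)

  child-of-build : ∀ {c} → ¬ HalfFull s c → child (shapeOf a) c a ≗ ch c
  child-of-build {c} nf i = begin
    child (shapeOf a) c a i     ≡⟨ cong (λ t → child t c a i) shape-of-build ⟩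
    child s c a i               ≡⟨ child-cong s c a≗ i ⟩
    child s c (build s ch) i    ≡⟨ child-build s ch c nf i ⟩
    ch c i                      ∎
    where open ≡-Reasoning

  child-member : ∀ {c β} → ¬ HalfFull s c → cons c β ∈⟦ a ⟧ ⇔ β ∈⟦ ch c ⟧
  child-member {c} {β} nf = mk⇔ into (λ d → in-child (∈-resp (λ i → sym (child-of-build nf i)) d))
    where
    into : cons c β ∈⟦ a ⟧ → β ∈⟦ ch c ⟧
    into (in-full h) = ⊥-elim (nf (subst (λ t → HalfFull t _) shape-of-build h))
    into (in-child d) = ∈-resp (child-of-build nf) d

-- Properness: following a proper half at every step gives a point outside ⟦a⟧.
avoidDir : Shape → Bool
avoidDir bothPartial = false
avoidDir leftFull = true
avoidDir rightFull = false

avoidDir-partial : ∀ s → ¬ HalfFull s (avoidDir s)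
avoidDir-partial bothPartial ()
avoidDir-partial leftFull ()
avoidDir-partial rightFull ()

avoid : Cantor → Cantor
avoid a zero = avoidDir (shapeOf a)
avoid a (suc i) = avoid (child (shapeOf a) (avoidDir (shapeOf a)) a) i

avoid-∉ : ∀ a → ¬ avoid a ∈⟦ a ⟧
avoid-∉ a (in-full h) = avoidDir-partial (shapeOf a) h
avoid-∉ a (in-child d) = avoid-∉ (child (shapeOf a) (avoidDir (shapeOf a)) a) d

decoded-proper : ∀ a → ¬ Full ⟦ a ⟧
decoded-proper a full = avoid-∉ a (full (avoid a))

halfFull-profile : ∀ a c → Full (Half c ⟦ a ⟧) → HalfFull (shapeOf a) c
halfFull-profile a c full with halfFull? (shapeOf a) c
... | yes h = h
... | no nh = ⊥-elim (decoded-proper (child (shapeOf a) c a)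
                        (λ β → to (child-member (build-eta a) nh) (full β)))

shape-determined : ∀ {a b} → ⟦ a ⟧ ≐ ⟦ b ⟧ → shapeOf a ≡ shapeOf b
shape-determined {a} {b} h = profile-injective (shapeOf a) (shapeOf b)
  (λ c hc → halfFull-profile b c (λ β → to (h (cons c β)) (in-full hc)))
  (λ c hc → halfFull-profile a c (λ β → from (h (cons c β)) (in-full hc)))

decode-injective : ∀ k {a b} → ⟦ a ⟧ ≐ ⟦ b ⟧ → Cyl a k b
decode-injective zero h i ()
decode-injective (suc k) {a} {b} h i i<k = begin
  b i                                   ≡⟨ b≗ i ⟩
  build s (λ c → child s c b) i         ≡⟨ build-causal s children-agree i i<k ⟩
  build s (λ c → child s c a) i         ≡⟨ sym (build-eta a i) ⟩
  a i                                   ∎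
  where
  open ≡-Reasoning
  s : Shape
  s = shapeOf a
  b≗ : b ≗ build s (λ c → child s c b)
  b≗ = build-eta-at (sym (shape-determined h))
  children-agree : ∀ c → ¬ HalfFull s c → Cyl (child s c a) k (child s c b)
  children-agree c nf = decode-injective k λ β →
    ⇔.trans (⇔.sym (child-member (build-eta a) nf)) (⇔.trans (h (cons c β)) (child-member b≗ nf))

shapeBy : {A B : Set} → Dec A → Dec B → Shape
shapeBy (yes _) _ = leftFull
shapeBy (no _) (yes _) = rightFull
shapeBy (no _) (no _) = bothPartial

shapeBy-full : ∀ (P : Bool → Set) (dl : Dec (P false)) (dr : Dec (P true)) c →
  HalfFull (shapeBy dl dr) c → P c
shapeBy-full P (yes l) _ false _ = l
shapeBy-full P (no _) (yes r) true _ = r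

shapeBy-partial : ∀ (P : Bool → Set) (dl : Dec (P false)) (dr : Dec (P true)) →
  ¬ (P false × P true) → ∀ c → ¬ HalfFull (shapeBy dl dr) c → ¬ P c
shapeBy-partial P (yes l) _ both true _ r = both (l , r)
shapeBy-partial P (yes _) _ _ false nh _ = nh tt
shapeBy-partial P (no nl) (yes _) _ false _ l = nl l
shapeBy-partial P (no _) (yes _) _ true nh _ = nh tt
shapeBy-partial P (no nl) (no _) _ false _ l = nl l
shapeBy-partial P (no _) (no nr) _ true _ r = nr r

module Encoding (em : ExcludedMiddle 0ℓ) where

  shape : Subset Cantor → Shape
  shape V = shapeBy (em {Full (Half false V)}) (em {Full (Half true V)})

  shape-full : ∀ {V} c → HalfFull (shape V) c → Full (Half c V)
  shape-full {V} = shapeBy-full (λ c → Full (Half c V)) em em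

  -- In a proper open set at most one half is full.
  shape-partial : ∀ {V} → IsOpenC V → ¬ Full V → ∀ c → ¬ HalfFull (shape V) c → ¬ Full (Half c V)
  shape-partial {V} oV nf = shapeBy-partial (λ c → Full (Half c V)) em em
    (λ (l , r) → nf (full-from-halves oV λ { false → l ; true → r }))

  approx : ℕ → Subset Cantor → Cantor
  approx zero V _ = false
  approx (suc n) V = build (shape V) (λ c → approx n (Half c V))

  code : Subset Cantor → Cantor
  code V i = approx (suc i) V i

  approx-stable : ∀ n V → Cyl (approx n V) n (approx (suc n) V)
  approx-stable zero V i ()
  approx-stable (suc n) V = build-causal (shape V) (λ c _ → approx-stable n (Half c V))

  approx-settle : ∀ d n V → Cyl (approx n V) n (approx (d + n) V)
  approx-settle zero n V i _ = refl
  approx-settle (suc d) n V i i<n =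
    trans (approx-stable (d + n) V i (<-≤-trans i<n (m≤n+m n d))) (approx-settle d n V i i<n)

  approx-code : ∀ n V j → j < n → approx n V j ≡ code V j
  approx-code n V j j<n = begin
    approx n V j              ≡⟨ sym (approx-settle (suc j) n V j j<n) ⟩
    approx (suc j + n) V j    ≡⟨ cong (λ m → approx m V j) (+-comm (suc j) n) ⟩
    approx (n + suc j) V j    ≡⟨ approx-settle n (suc j) V j (n<1+n j) ⟩
    code V j                  ∎
    where open ≡-Reasoning

  code-unfold : ∀ V → code V ≗ build (shape V) (λ c → code (Half c V))
  code-unfold V i = sym (build-causal (shape V)
    (λ c _ j j<i → sym (approx-code i (Half c V) j j<i)) i (n<1+n i))

  code-shape : ∀ {a V} → a ≗ code V → shapeOf a ≡ shape V
  code-shape {V = V} p = shape-of-build (λ i → trans (p i) (code-unfold V i))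

  code-children : ∀ {a V c} → a ≗ code V → ¬ HalfFull (shape V) c →
    child (shapeOf a) c a ≗ code (Half c V)
  code-children {V = V} p = child-of-build (λ i → trans (p i) (code-unfold V i))

  sound : ∀ {V y a} → IsOpenC V → a ≗ code V → y ∈⟦ a ⟧ → V y
  sound {V} {y} oV p d with halfFull? (shape V) (y 0)
  ... | yes h = from-half oV (shape-full {V} (y 0) h (tl y))
  sound {V} oV p (in-full h)  | no nh = ⊥-elim (nh (subst (λ s → HalfFull s _) (code-shape {V = V} p) h))
  sound {V} oV p (in-child d) | no nh = from-half oV (sound (Half-open _ oV) (code-children {V = V} p nh) d)

  complete : ∀ k {V y} → IsOpenC V → ¬ Full V → (∀ β → Cyl y k β → V β) → y ∈⟦ code V ⟧
  complete zero oV nf nb = ⊥-elim (nf (λ β → nb β (λ _ ())))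
  complete (suc k) {V} {y} oV nf nb with halfFull? (shape V) (y 0)
  ... | yes h = in-full (subst (λ s → HalfFull s (y 0)) (sym (code-shape {V = V} (λ _ → refl))) h)
  ... | no nh = in-child (∈-resp (λ i → sym (code-children {V = V} (λ _ → refl) nh i))
                  (complete k (Half-open (y 0) oV) (shape-partial {V} oV nf (y 0) nh)
                     (λ β cy → nb (cons (y 0) β) (cons-cyl cy))))

  code-correct : ∀ {V} → IsOpenC V → ¬ Full V → ⟦ code V ⟧ ≐ V
  code-correct oV nf y = mk⇔ (sound oV (λ _ → refl))
                             (λ v → let (k , nb) = oV y v in complete k oV nf nb)

U : Subset (X × Cantor)
U (inj₁ a , y) = y ∈⟦ a ⟧
U (inj₂ _ , y) = ⊤

U-open : IsOpenXC U
U-open (inj₁ a) y d =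
  let (m , n , nb) = ∈-open d
  in m , n , λ { (inj₁ a') y' ca cy → nb a' y' ca cy ; (inj₂ _) _ () _ }
U-open (inj₂ _) y _ = 0 , 0 , λ { (inj₁ _) _ () _ ; (inj₂ _) _ _ _ → tt }

U-injective : ∀ x x' → section U x ≐ section U x' → x ≈X x'
U-injective (inj₁ a) (inj₁ b) h i = sym (decode-injective (suc i) h i (n<1+n i))
U-injective (inj₁ a) (inj₂ _) h = ⊥-elim (decoded-proper a (λ β → from (h β) tt))
U-injective (inj₂ _) (inj₁ b) h = ⊥-elim (decoded-proper b (λ β → to (h β) tt))
U-injective (inj₂ _) (inj₂ _) _ = tt

proposition3 : ExcludedMiddle 0ℓ → UU-X×Cantor
proposition3 em = U , U-open , λ W oW →
  let (x , Ux≐W) = representative W oW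
  in x , Ux≐W , λ x' Ux'≐W → U-injective x' x (λ β → ⇔.trans (Ux'≐W β) (⇔.sym (Ux≐W β)))
  where
  open Encoding em
  representative : (W : Subset Cantor) → IsOpenC W → Σ X λ x → section U x ≐ W
  representative W oW with em {Full W}
  ... | yes full = inj₂ tt , λ β → mk⇔ (λ _ → full β) (λ _ → tt)
  ... | no proper = inj₁ (code W) , code-correct oW proper
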